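{- Let $g,g^*:\mathbb N\to\mathbb C$ be arbitrary functions and put $f(n)=\sum_{d\mid n}g(d)$. Assume that $f(n)=\sum_{d\mid\mid n}g^*(d)$ for all $n\in\mathbb N$. Then for all $n\in\mathbb N$, $$g^*(n)=\sum_{\substack{d\mid n\\ \kappa(d)=\kappa(n)}}g(d)\qquad\text{and}\qquad g(n)=\sum_{\substack{d\mid n\\ \kappa(d)=\kappa(n)}}g^*(d)\,\mu(n/d).$$
   Context: $d\mid\mid n$ means $d\mid n$ and $\gcd(d,n/d)=1$ (unitary divisor). $\kappa(n)=\prod_{p\mid n}p$ is the squarefree kernel of $n$. $\mu$ is the Möbius function. -}

module Defs where

open import Level using (Level)
open import Data.Bool using (Bool; true; false; if_then_else_; _∧_; not)
open import Data.Nat using (ℕ; zero; suc; _*_; _/_)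
open import Data.Nat.Divisibility using (_∣?_)
open import Data.Nat.GCD using (gcd)
open import Data.Nat.Primality using (prime?)
open import Data.List using (List; foldr; filter; length; upTo; map)
open import Data.Bool.ListAction using (any)
open import Data.Integer using (ℤ; +_; -[1+_])
open import Relation.Nullary using (does)
open import Algebra.Bundles using (CommutativeRing)

range1 : ℕ → List ℕ
range1 n = map suc (upTo n)

divides : ℕ → ℕ → Bool
divides d n = does (d ∣? n)

isPrime : ℕ → Bool
isPrime p = does (prime? p)

eqℕ : ℕ → ℕ → Bool
eqℕ m n = does (m Data.Nat.≟ n)

primeDivisors : ℕ → List ℕ
primeDivisors n = filter (λ p → prime? p Relation.Nullary.×-dec p ∣? n) (range1 n)

kappa : ℕ → ℕ
kappa n = foldr _*_ 1 (primeDivisors n)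

squarefree : ℕ → Bool
squarefree n = not (any (λ p → divides (p * p) n) (primeDivisors n))

parity : ℕ → ℤ
parity zero = + 1
parity (suc zero) = -[1+ 0 ]
parity (suc (suc k)) = parity k

mobius : ℕ → ℤ
mobius n = if squarefree n then parity (length (primeDivisors n)) else + 0

-- n / d for d ≥ 1 (d = 0 never occurs: all divisors range over 1..n)
quot : ℕ → ℕ → ℕ
quot n zero = 0
quot n (suc k) = n / suc k

unitary : ℕ → ℕ → Bool
unitary zero n = false
unitary (suc k) n = divides (suc k) n ∧ eqℕ (gcd (suc k) (n / suc k)) 1

module Sums {c ℓ : Level} (R : CommutativeRing c ℓ) where
  open CommutativeRing R renaming (_*_ to _·_)

  natR : ℕ → Carrier
  natR zero = 0#
  natR (suc n) = 1# + natR n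

  intR : ℤ → Carrier
  intR (+ n) = natR n
  intR -[1+ n ] = - natR (suc n)

  sumWhere : ℕ → (ℕ → Bool) → (ℕ → Carrier) → Carrier
  sumWhere n P h = foldr (λ d acc → (if P d then h d else 0#) + acc) 0# (range1 n)

  divSum : (ℕ → Carrier) → ℕ → Carrier
  divSum h n = sumWhere n (λ d → divides d n) h

  unitarySum : (ℕ → Carrier) → ℕ → Carrier
  unitarySum h n = sumWhere n (λ d → unitary d n) h

  kernelSum : (ℕ → Carrier) → ℕ → Carrier
  kernelSum h n = sumWhere n (λ d → divides d n ∧ eqℕ (kappa d) (kappa n)) h

  kernelMobiusSum : (ℕ → Carrier) → ℕ → Carrier
  kernelMobiusSum h n = kernelSum (λ d → h d · intR (mobius (quot n d))) n

-- Every divisor e of n lies in exactly one unitary divisor d ∥ n with κ(d) = κ(e): it is reached by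
-- multiplying e by primes common to the divisor and its cofactor until these are coprime, and two
-- unitary divisors of n with the same prime factors divide each other. Hence
-- Σ_{e ∣ n} g(e) = Σ_{d ∥ n} Σ_{e ∣ d, κ(e) = κ(d)} g(e), and as the sums Σ_{d ≤ n, Q(d,n)} a(d) with
-- Q(n,n) form a unitriangular system, g* is the kernel sum of g. Conversely μ inverts the kernel sum:
-- if κ(e) = κ(n), every d with e ∣ d ∣ n also has κ(d) = κ(n), so the double sum collapses to
-- Σ_{j ∣ n/e} μ(j) = [e = n], and unitriangularity recovers g from g*.
module Submission where

open import Defs
open import Level using (Level)
open import Algebra.Bundles using (CommutativeMonoid; CommutativeRing)
open import Data.Bool using (Bool; true; false; T; if_then_else_; _∧_; not)
open import Data.Bool.ListAction using (any)
open import Data.Bool.Properties using (T-∧; T-≡)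
open import Data.Empty using (⊥-elim)
open import Data.Integer as ℤ using (+_)
open import Data.Integer.Properties using (neg-involutive)
open import Data.List using ([]; _∷_; _++_; map; filter; length; upTo; foldr)
open import Data.List.Membership.Propositional using (_∈_; find; lose)
open import Data.List.Membership.Propositional.Properties
  using (∈-map⁺; ∈-map⁻; ∈-upTo⁺; ∈-upTo⁻; ∈-filter⁺; ∈-filter⁻)
open import Data.List.Properties
  using (upTo-∷ʳ; map-++; filter-++; filter-≐; filter-accept; filter-reject; filter-none; ++-identityʳ; foldr-++)
open import Data.List.Relation.Unary.All as All using (All)
open import Data.List.Relation.Unary.Any.Properties using (any⁺; any⁻)
open import Data.Nat as ℕ
  using ( ℕ; zero; suc; _*_; _≤_; _<_; z≤n; s≤s; s≤s⁻¹; _≟_; _/_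
        ; NonZero; NonTrivial; >-nonZero; >-nonZero⁻¹; ≢-nonZero⁻¹; nonTrivial⇒n>1)
open import Data.Nat.Properties
  using ( ≤-refl; ≤-reflexive; ≤-trans; <⇒≤; <⇒≱; <⇒≢; >⇒≢; m≤n⇒m<n∨m≡n; m≤n⇒m≤1+n; m≤n+m; m≤m*n; m≤n*m; m<m*n
        ; +-comm; +-suc; *-comm; *-assoc; *-identityˡ; *-cancelʳ-<; *-cancelʳ-≡; m*n≢0⇒m≢0)
open import Data.Nat.Divisibility hiding (divides)
open import Data.Nat.Divisibility.Core using () renaming (divides to mk∣)
open import Data.Nat.DivMod using (m*n/n≡m)
open import Data.Nat.Coprimality using (Coprime; coprime-divisor; gcd≡1⇒coprime; coprime⇒gcd≡1)
open import Data.Nat.GCD using (gcd; gcd[m,n]∣m; gcd[m,n]∣n; gcd[m,n]≡0⇒m≡0)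
open import Data.Nat.Induction using (<-wellFounded; <-rec)
open import Data.Nat.ListAction using (product)
open import Data.Nat.ListAction.Properties using (∈⇒∣product)
open import Data.Nat.Primality
  using (Prime; prime?; euclidsLemma; prime⇒irreducible; prime⇒nonZero; prime⇒nonTrivial)
open import Data.Nat.Primality.Factorisation using (factorise; factorisationHasAllPrimeFactors)
open import Data.Product using (_×_; _,_; proj₁; proj₂; ∃-syntax; Σ-syntax)
open import Data.Sum using (_⊎_; inj₁; inj₂; [_,_])
open import Data.Unit using (tt)
open import Function using (id; _∘_; _⇔_; mk⇔; Equivalence)
open import Induction.WellFounded using (Acc; acc)
open import Relation.Nullary using (Dec; yes; no; does; ¬_; _×-dec_; contradiction)
open import Relation.Nullary.Decidable using (dec-true; does-⇔)
open import Relation.Unary using (Pred; Decidable)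
open import Relation.Binary.PropositionalEquality
  using (_≡_; _≢_; refl; sym; trans; cong; cong₂; subst; module ≡-Reasoning)

private
  variable
    a : Level
    A : Set a
    d e k m n p q N d₁ d₂ : ℕ

T-does⁻ : (a? : Dec A) → T (does a?) → A
T-does⁻ (yes a) _ = a

T-does⁺ : (a? : Dec A) → A → T (does a?)
T-does⁺ (yes _) _ = tt
T-does⁺ (no ¬a) a = ¬a a

T-⇔⇒≡ : ∀ {x y} → T x ⇔ T y → x ≡ y
T-⇔⇒≡ {false} {false} _ = refl
T-⇔⇒≡ {false} {true} x⇔y = ⊥-elim (Equivalence.from x⇔y tt)
T-⇔⇒≡ {true} {false} x⇔y = ⊥-elim (Equivalence.to x⇔y tt)
T-⇔⇒≡ {true} {true} _ = refl

range1-suc : ∀ n → range1 (suc n) ≡ range1 n ++ suc n ∷ []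
range1-suc n = trans (cong (map suc) (sym (upTo-∷ʳ n))) (map-++ suc (upTo n) (n ∷ []))

∈-range1⁺ : 1 ≤ q → q ≤ n → q ∈ range1 n
∈-range1⁺ {suc q} _ q<n = ∈-map⁺ suc (∈-upTo⁺ q<n)

∈-range1⁻ : q ∈ range1 n → q ≤ n
∈-range1⁻ q∈ with _ , i∈ , refl ← ∈-map⁻ suc q∈ = ∈-upTo⁻ i∈

module _ {P : Pred ℕ a} (P? : Decidable P) where

  filter-range1-bounded : (∀ {q} → P q → q ≤ n) → n ≤ N → filter P? (range1 N) ≡ filter P? (range1 n)
  filter-range1-bounded {N = zero} _ z≤n = refl
  filter-range1-bounded {n} {suc N} bound n≤1+N with m≤n⇒m<n∨m≡n n≤1+N
  ... | inj₂ refl = refl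
  ... | inj₁ (s≤s n≤N) = begin
    filter P? (range1 (suc N))                 ≡⟨ cong (filter P?) (range1-suc N) ⟩
    filter P? (range1 N ++ suc N ∷ [])         ≡⟨ filter-++ P? (range1 N) _ ⟩
    filter P? (range1 N) ++ filter P? (suc N ∷ [])
      ≡⟨ cong (filter P? (range1 N) ++_) (filter-reject P? (<⇒≱ (s≤s n≤N) ∘ bound)) ⟩
    filter P? (range1 N) ++ []                 ≡⟨ ++-identityʳ _ ⟩
    filter P? (range1 N)                       ≡⟨ filter-range1-bounded bound n≤N ⟩
    filter P? (range1 n)                       ∎
    where open ≡-Reasoning

filter-≟-range1 : 1 ≤ p → p ≤ N → filter (_≟ p) (range1 N) ≡ p ∷ []
filter-≟-range1 {suc p} {N} _ p≤N = begin
  filter (_≟ suc p) (range1 N)                  ≡⟨ filter-range1-bounded (_≟ suc p) ≤-reflexive p≤N ⟩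
  filter (_≟ suc p) (range1 (suc p))            ≡⟨ cong (filter (_≟ suc p)) (range1-suc p) ⟩
  filter (_≟ suc p) (range1 p ++ suc p ∷ [])    ≡⟨ filter-++ (_≟ suc p) (range1 p) _ ⟩
  filter (_≟ suc p) (range1 p) ++ filter (_≟ suc p) (suc p ∷ [])
    ≡⟨ cong₂ _++_ (filter-none (_≟ suc p) (All.tabulate (λ q∈ → <⇒≢ (s≤s (∈-range1⁻ q∈)))))
                  (filter-accept (_≟ suc p) refl) ⟩
  suc p ∷ []                                    ∎
  where open ≡-Reasoning

module _ {P Q R : Pred ℕ a} (P? : Decidable P) (Q? : Decidable Q) (R? : Decidable R)
         (P⇔Q⊎R : ∀ {x} → P x ⇔ (Q x ⊎ R x)) (Q⇒¬R : ∀ {x} → Q x → ¬ R x) where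

  length-filter-⊎ : ∀ xs → length (filter P? xs) ≡ length (filter Q? xs) ℕ.+ length (filter R? xs)
  length-filter-⊎ [] = refl
  length-filter-⊎ (x ∷ xs) with ih ← length-filter-⊎ xs | P? x | Q? x | R? x
  ... | yes _  | yes _  | no _   = cong suc ih
  ... | yes _  | no _   | yes _  = trans (cong suc ih) (sym (+-suc _ _))
  ... | no _   | no _   | no _   = ih
  ... | yes Px | no ¬Qx | no ¬Rx = contradiction (Equivalence.to P⇔Q⊎R Px) [ ¬Qx , ¬Rx ]
  ... | no ¬Px | yes Qx | _      = contradiction (Equivalence.from P⇔Q⊎R (inj₁ Qx)) ¬Px
  ... | no ¬Px | _      | yes Rx = contradiction (Equivalence.from P⇔Q⊎R (inj₂ Rx)) ¬Px
  ... | yes _  | yes Qx | yes Rx = contradiction Rx (Q⇒¬R Qx)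

-- Divisibility and primes

prime≢1 : Prime p → p ≢ 1
prime≢1 pp refl = NonTrivial.nonTrivial (prime⇒nonTrivial pp)

prime≥1 : Prime p → 1 ≤ p
prime≥1 {p} pp = >-nonZero⁻¹ p {{prime⇒nonZero pp}}

prime∣prime⇒≡ : Prime p → Prime q → p ∣ q → p ≡ q
prime∣prime⇒≡ pp pq p∣q with prime⇒irreducible pq p∣q
... | inj₁ p≡1 = contradiction p≡1 (prime≢1 pp)
... | inj₂ p≡q = p≡q

∃-prime-divisor : 1 < n → ∃[ p ] Prime p × p ∣ n
∃-prime-divisor {suc zero} (s≤s ())
∃-prime-divisor {suc (suc n)} _ with factorise (suc (suc n))
... | record { factors = p ∷ ps ; isFactorisation = eq ; factorsPrime = pp All.∷ _ } =
  p , pp , subst (p ∣_) (sym eq) (m∣m*n (product ps))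

∤-between-multiples : m * e < n → n < suc m * e → ¬ e ∣ n
∤-between-multiples {m} {e} me<qe qe<me+e (divides-refl q) =
  <⇒≱ (*-cancelʳ-< e m q me<qe) (s≤s⁻¹ (*-cancelʳ-< e q (suc m) qe<me+e))

cofactor≡1⇔ : 1 ≤ e → n ≡ m * e → m ≡ 1 ⇔ e ≡ n
cofactor≡1⇔ {e} {n} {m} 1≤e n≡me = mk⇔
  (λ { refl → sym (trans n≡me (*-identityˡ e)) })
  (λ e≡n → *-cancelʳ-≡ m 1 e {{>-nonZero 1≤e}} (trans (sym n≡me) (trans (sym e≡n) (sym (*-identityˡ e)))))

quot[m*n,n]≡m : ∀ m → 1 ≤ e → quot (m * e) e ≡ m
quot[m*n,n]≡m {suc e} m _ = m*n/n≡m m (suc e)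

positive-divisor : 1 ≤ n → d ∣ n → 1 ≤ d
positive-divisor {d = zero} 1≤n 0∣n = contradiction (0∣⇒≡0 0∣n) (≢-nonZero⁻¹ _ {{>-nonZero 1≤n}})
positive-divisor {d = suc d} _ _ = s≤s z≤n

divisor-≤ : 1 ≤ n → d ∣ n → d ≤ n
divisor-≤ 1≤n = ∣⇒≤ {{>-nonZero 1≤n}}

prime∤⇒coprime : Prime p → ¬ p ∣ m → Coprime m p
prime∤⇒coprime pp p∤m (c∣m , c∣p) with prime⇒irreducible pp c∣p
... | inj₁ c≡1 = c≡1
... | inj₂ refl = contradiction c∣m p∤m

coprime⊎common-prime : 1 ≤ m → Coprime m n ⊎ ∃[ p ] Prime p × p ∣ m × p ∣ n
coprime⊎common-prime {m} {n} 1≤m with gcd m n in eq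
... | zero = contradiction (gcd[m,n]≡0⇒m≡0 eq) (≢-nonZero⁻¹ _ {{>-nonZero 1≤m}})
... | suc zero = inj₁ (gcd≡1⇒coprime eq)
... | suc (suc g) with p , pp , p∣g ← ∃-prime-divisor {suc (suc g)} (s≤s (s≤s z≤n)) =
  inj₂ (p , pp , ∣-trans p∣g (subst (_∣ m) eq (gcd[m,n]∣m m n)) ,
                 ∣-trans p∣g (subst (_∣ n) eq (gcd[m,n]∣n m n)))

coprime⇒¬common-prime : Coprime m n → Prime p → p ∣ m → ¬ p ∣ n
coprime⇒¬common-prime cop pp p∣m p∣n = prime≢1 pp (cop (p∣m , p∣n))

-- Prime divisors and the kernel κ

_⊆ₚ_ : ℕ → ℕ → Set
m ⊆ₚ n = ∀ {p} → Prime p → p ∣ m → p ∣ n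

∣⇒⊆ₚ : m ∣ n → m ⊆ₚ n
∣⇒⊆ₚ m∣n _ p∣m = ∣-trans p∣m m∣n

primeDivisor? : ∀ n → Decidable (λ p → Prime p × p ∣ n)
primeDivisor? n p = prime? p ×-dec p ∣? n

∈-primeDivisors⁻ : p ∈ primeDivisors n → Prime p × p ∣ n
∈-primeDivisors⁻ {n = n} = proj₂ ∘ ∈-filter⁻ (primeDivisor? n) {xs = range1 n}

∈-primeDivisors⁺ : 1 ≤ n → Prime p → p ∣ n → p ∈ primeDivisors n
∈-primeDivisors⁺ 1≤n pp p∣n =
  ∈-filter⁺ (primeDivisor? _) (∈-range1⁺ (prime≥1 pp) (divisor-≤ 1≤n p∣n)) (pp , p∣n)

⊆ₚ-antisym⇒primeDivisors-≡ : 1 ≤ m → 1 ≤ n → m ⊆ₚ n → n ⊆ₚ m → primeDivisors m ≡ primeDivisors n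
⊆ₚ-antisym⇒primeDivisors-≡ {m} {n} 1≤m 1≤n m⊆n n⊆m = begin
  filter (primeDivisor? m) (range1 m)
    ≡⟨ filter-range1-bounded (primeDivisor? m) (divisor-≤ 1≤m ∘ proj₂) (m≤m*n m n {{>-nonZero 1≤n}}) ⟨
  filter (primeDivisor? m) (range1 (m * n))
    ≡⟨ filter-≐ (primeDivisor? m) (primeDivisor? n) (same m⊆n , same n⊆m) (range1 (m * n)) ⟩
  filter (primeDivisor? n) (range1 (m * n))
    ≡⟨ filter-range1-bounded (primeDivisor? n) (divisor-≤ 1≤n ∘ proj₂) (m≤n*m n m {{>-nonZero 1≤m}}) ⟩
  filter (primeDivisor? n) (range1 n)
    ∎
  where
  open ≡-Reasoning
  same : ∀ {a b} → a ⊆ₚ b → ∀ {q} → Prime q × q ∣ a → Prime q × q ∣ b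
  same a⊆b (pq , q∣a) = pq , a⊆b pq q∣a

⊆ₚ-antisym⇒kappa-≡ : 1 ≤ m → 1 ≤ n → m ⊆ₚ n → n ⊆ₚ m → kappa m ≡ kappa n
⊆ₚ-antisym⇒kappa-≡ 1≤m 1≤n m⊆n n⊆m = cong (foldr _*_ 1) (⊆ₚ-antisym⇒primeDivisors-≡ 1≤m 1≤n m⊆n n⊆m)

kappa-≡⇒⊆ₚ : 1 ≤ m → kappa m ≡ kappa n → m ⊆ₚ n
kappa-≡⇒⊆ₚ {m} {n} 1≤m κm≡κn {p} pp p∣m = proj₂ (∈-primeDivisors⁻ p∈primeDivisors[n])
  where
  p∣κn : p ∣ kappa n
  p∣κn = subst (p ∣_) κm≡κn (∈⇒∣product (∈-primeDivisors⁺ 1≤m pp p∣m))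
  p∈primeDivisors[n] : p ∈ primeDivisors n
  p∈primeDivisors[n] = factorisationHasAllPrimeFactors pp p∣κn (All.tabulate (proj₁ ∘ ∈-primeDivisors⁻ {n = n}))

_∣κ_ : ℕ → ℕ → Set
e ∣κ d = e ∣ d × kappa e ≡ kappa d

_∣κ?_ : ∀ e d → Dec (e ∣κ d)
e ∣κ? d = e ∣? d ×-dec kappa e ≟ kappa d

∣κ-refl : n ∣κ n
∣κ-refl = ∣-refl , refl

∣κ-trans : e ∣κ d → d ∣κ n → e ∣κ n
∣κ-trans (e∣d , κe≡κd) (d∣n , κd≡κn) = ∣-trans e∣d d∣n , trans κe≡κd κd≡κn

∣κ-between : 1 ≤ n → e ∣κ n → (d ∣κ n × e ∣κ d) ⇔ (e ∣ d × d ∣ n)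
∣κ-between {n} {e} {d} 1≤n (e∣n , κe≡κn) = mk⇔ (λ (d∣κn , e∣κd) → proj₁ e∣κd , proj₁ d∣κn) from
  where
  from : e ∣ d × d ∣ n → d ∣κ n × e ∣κ d
  from (e∣d , d∣n) = (d∣n , κd≡κn) , (e∣d , trans κe≡κn (sym κd≡κn))
    where
    n⊆ₚd : n ⊆ₚ d
    n⊆ₚd pp p∣n = ∣-trans (kappa-≡⇒⊆ₚ 1≤n (sym κe≡κn) pp p∣n) e∣d
    κd≡κn = ⊆ₚ-antisym⇒kappa-≡ (positive-divisor 1≤n d∣n) 1≤n (∣⇒⊆ₚ d∣n) n⊆ₚd

-- The Möbius function

HasSquarePrimeFactor : ℕ → Set
HasSquarePrimeFactor n = ∃[ p ] Prime p × p * p ∣ n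

any-square-primeDivisors⇔ : 1 ≤ n → T (any (λ p → divides (p * p) n) (primeDivisors n)) ⇔ HasSquarePrimeFactor n
any-square-primeDivisors⇔ {n} 1≤n = mk⇔ to from
  where
  to : T (any (λ p → divides (p * p) n) (primeDivisors n)) → HasSquarePrimeFactor n
  to t with p , p∈ , pp∣n ← find (any⁻ _ (primeDivisors n) t) =
    p , proj₁ (∈-primeDivisors⁻ {n = n} p∈) , T-does⁻ (p * p ∣? n) pp∣n
  from : HasSquarePrimeFactor n → T (any (λ p → divides (p * p) n) (primeDivisors n))
  from (p , pp , pp∣n) =
    any⁺ _ (lose (∈-primeDivisors⁺ 1≤n pp (∣-trans (m∣m*n p) pp∣n)) (T-does⁺ (p * p ∣? n) pp∣n))

square-factor-*prime : Prime p → ¬ p ∣ k → HasSquarePrimeFactor (k * p) ⇔ HasSquarePrimeFactor k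
square-factor-*prime {p} {k} pp p∤k = mk⇔ to from
  where
  to : HasSquarePrimeFactor (k * p) → HasSquarePrimeFactor k
  to (q , pq , qq∣kp) with q ≟ p
  ... | yes refl = contradiction (*-cancelʳ-∣ q {{prime⇒nonZero pq}} qq∣kp) p∤k
  ... | no q≢p = q , pq , coprime-divisor (prime∤⇒coprime pp p∤qq) (subst (q * q ∣_) (*-comm k p) qq∣kp)
    where
    p∤q : ¬ p ∣ q
    p∤q p∣q = q≢p (sym (prime∣prime⇒≡ pp pq p∣q))
    p∤qq : ¬ p ∣ q * q
    p∤qq p∣qq = [ p∤q , p∤q ] (euclidsLemma q q pp p∣qq)
  from : HasSquarePrimeFactor k → HasSquarePrimeFactor (k * p)
  from (q , pq , qq∣k) = q , pq , ∣m⇒∣m*n p qq∣k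

squarefree-cong : 1 ≤ m → 1 ≤ n → HasSquarePrimeFactor m ⇔ HasSquarePrimeFactor n → squarefree m ≡ squarefree n
squarefree-cong 1≤m 1≤n m⇔n = cong not (T-⇔⇒≡ (mk⇔ (N.from ∘ to ∘ M.to) (M.from ∘ from ∘ N.to)))
  where
  open Equivalence m⇔n
  module M = Equivalence (any-square-primeDivisors⇔ 1≤m)
  module N = Equivalence (any-square-primeDivisors⇔ 1≤n)

length-primeDivisors-*prime : 1 ≤ k → Prime p → ¬ p ∣ k →
                              length (primeDivisors (k * p)) ≡ suc (length (primeDivisors k))
length-primeDivisors-*prime {k} {p} 1≤k pp p∤k = begin
  length (filter (primeDivisor? (k * p)) (range1 (k * p)))
    ≡⟨ length-filter-⊎ (primeDivisor? (k * p)) (primeDivisor? k) (_≟ p) split disjoint (range1 (k * p)) ⟩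
  length (filter (primeDivisor? k) (range1 (k * p))) ℕ.+ length (filter (_≟ p) (range1 (k * p)))
    ≡⟨ cong₂ (λ xs ys → length xs ℕ.+ length ys)
             (filter-range1-bounded (primeDivisor? k) (divisor-≤ 1≤k ∘ proj₂) (m≤m*n k p {{prime⇒nonZero pp}}))
             (filter-≟-range1 (prime≥1 pp) (m≤n*m p k {{>-nonZero 1≤k}})) ⟩
  length (primeDivisors k) ℕ.+ 1
    ≡⟨ +-comm _ 1 ⟩
  suc (length (primeDivisors k)) ∎
  where
  open ≡-Reasoning
  split : ∀ {q} → (Prime q × q ∣ k * p) ⇔ ((Prime q × q ∣ k) ⊎ q ≡ p)
  split {q} = mk⇔ to from
    where
    to : Prime q × q ∣ k * p → (Prime q × q ∣ k) ⊎ q ≡ p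
    to (pq , q∣kp) = Data.Sum.map (pq ,_) (prime∣prime⇒≡ pq pp) (euclidsLemma k p pq q∣kp)
    from : (Prime q × q ∣ k) ⊎ q ≡ p → Prime q × q ∣ k * p
    from (inj₁ (pq , q∣k)) = pq , ∣m⇒∣m*n p q∣k
    from (inj₂ refl) = pp , n∣m*n k
  disjoint : ∀ {q} → Prime q × q ∣ k → q ≢ p
  disjoint (_ , q∣k) refl = p∤k q∣k

parity-suc : ∀ n → parity (suc n) ≡ ℤ.- parity n
parity-suc zero = refl
parity-suc (suc n) = trans (sym (neg-involutive (parity n))) (cong ℤ.-_ (sym (parity-suc n)))

mobius-square : 1 ≤ k → Prime p → p * p ∣ k → mobius k ≡ + 0
mobius-square {k} 1≤k pp pp∣k = cong (λ b → if b then parity (length (primeDivisors k)) else + 0) nonsquarefree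
  where
  nonsquarefree : squarefree k ≡ false
  nonsquarefree =
    cong not (Equivalence.to T-≡ (Equivalence.from (any-square-primeDivisors⇔ 1≤k) (_ , pp , pp∣k)))

mobius-*prime : 1 ≤ k → Prime p → ¬ p ∣ k → mobius (k * p) ≡ ℤ.- mobius k
mobius-*prime {k} {p} 1≤k pp p∤k = begin
  mobius (k * p)
    ≡⟨ cong₂ (λ b l → if b then parity l else + 0)
             (squarefree-cong 1≤kp 1≤k (square-factor-*prime pp p∤k))
             (length-primeDivisors-*prime 1≤k pp p∤k) ⟩
  (if squarefree k then parity (suc ω) else + 0) ≡⟨ flip-sign (squarefree k) ⟩
  ℤ.- mobius k ∎
  where
  open ≡-Reasoning
  1≤kp = ≤-trans 1≤k (m≤m*n k p {{prime⇒nonZero pp}})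
  ω = length (primeDivisors k)
  flip-sign : ∀ b → (if b then parity (suc ω) else + 0) ≡ ℤ.- (if b then parity ω else + 0)
  flip-sign true = parity-suc ω
  flip-sign false = refl

-- Unitary divisors

_∥_ : ℕ → ℕ → Set
d ∥ n = Σ[ d∣n ∈ d ∣ n ] Coprime d (quotient d∣n)

unitary⇒∥ : T (unitary d n) → d ∥ n
unitary⇒∥ {suc k} {n} t = d∣n , gcd≡1⇒coprime (trans (cong (gcd (suc k)) (sym (n/m≡quotient d∣n))) gcd≡1)
  where
  d∣n = T-does⁻ (suc k ∣? n) (proj₁ (Equivalence.to T-∧ t))
  gcd≡1 = T-does⁻ (gcd (suc k) (n / suc k) ≟ 1) (proj₂ (Equivalence.to T-∧ t))

∥⇒unitary : 1 ≤ d → d ∥ n → T (unitary d n)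
∥⇒unitary {suc k} {n} _ (d∣n , d⊥q) = Equivalence.from T-∧
  ( T-does⁺ (suc k ∣? n) d∣n
  , T-does⁺ (gcd (suc k) (n / suc k) ≟ 1) (trans (cong (gcd (suc k)) (n/m≡quotient d∣n)) (coprime⇒gcd≡1 d⊥q)))

∥-refl : n ∥ n
∥-refl = ∣-refl , ∣1⇒≡1 ∘ proj₂

∥-absorb : 1 ≤ e → d ∥ n → e ∣ n → e ⊆ₚ d → e ∣ d
∥-absorb 1≤e (mk∣ q n≡qd , d⊥q) e∣n e⊆d = coprime-divisor e⊥q (subst (_ ∣_) n≡qd e∣n)
  where
  e⊥q : Coprime _ q
  e⊥q with coprime⊎common-prime 1≤e
  ... | inj₁ e⊥q = e⊥q
  ... | inj₂ (p , pp , p∣e , p∣q) = contradiction p∣q (coprime⇒¬common-prime d⊥q pp (e⊆d pp p∣e))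

∥-unique : 1 ≤ n → d₁ ∥ n → d₂ ∥ n → d₁ ⊆ₚ d₂ → d₂ ⊆ₚ d₁ → d₁ ≡ d₂
∥-unique 1≤n u₁ u₂ d₁⊆d₂ d₂⊆d₁ =
  ∣-antisym (∥-absorb (positive u₁) u₂ (proj₁ u₁) d₁⊆d₂) (∥-absorb (positive u₂) u₁ (proj₁ u₂) d₂⊆d₁)
  where
  positive : ∀ {d} → d ∥ _ → 1 ≤ d
  positive = positive-divisor 1≤n ∘ proj₁

-- The cofactor strictly decreases while the prime factors of the divisor stay those of e.
∥-saturate : 1 ≤ n → e ∣ n → ∃[ d ] d ∥ n × e ∣ d × d ⊆ₚ e
∥-saturate {n} {e} 1≤n (mk∣ q n≡qe) = grow q (<-wellFounded q) e n≡qe ∣-refl (λ _ → id)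
  where
  grow : ∀ q → Acc _<_ q → ∀ d → n ≡ q * d → e ∣ d → d ⊆ₚ e → ∃[ d′ ] d′ ∥ n × e ∣ d′ × d′ ⊆ₚ e
  grow q (acc smaller) d n≡qd e∣d d⊆e with coprime⊎common-prime {d} {q} (positive-divisor 1≤n (mk∣ q n≡qd))
  ... | inj₁ d⊥q = d , (mk∣ q n≡qd , d⊥q) , e∣d , d⊆e
  ... | inj₂ (r , pr , r∣d , mk∣ q′ q≡q′r) =
    grow q′ (smaller q′<q) (d * r) n≡q′[dr] (∣m⇒∣m*n r e∣d) dr⊆e
    where
    n≡q′[dr] : n ≡ q′ * (d * r)
    n≡q′[dr] = trans n≡qd (trans (cong (_* d) q≡q′r) (trans (*-assoc q′ r d) (cong (q′ *_) (*-comm r d))))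
    1≤q : 1 ≤ q
    1≤q = positive-divisor 1≤n (mk∣ d (trans n≡qd (*-comm q d)))
    q′<q : q′ < q
    q′<q = subst (q′ <_) (sym q≡q′r) (m<m*n q′ r {{q′≢0}} (nonTrivial⇒n>1 r {{prime⇒nonTrivial pr}}))
      where q′≢0 = m*n≢0⇒m≢0 q′ {{subst NonZero q≡q′r (>-nonZero 1≤q)}}
    dr⊆e : (d * r) ⊆ₚ e
    dr⊆e pt t∣dr with euclidsLemma d r pt t∣dr
    ... | inj₁ t∣d = d⊆e pt t∣d
    ... | inj₂ t∣r = d⊆e pt (subst (_∣ d) (sym (prime∣prime⇒≡ pt pr t∣r)) r∣d)

module RangeSum {c ℓ} (M : CommutativeMonoid c ℓ) where

  open CommutativeMonoid M renaming (refl to ≈-refl; sym to ≈-sym; trans to ≈-trans; reflexive to ≈-reflexive)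
  open import Algebra.Properties.CommutativeSemigroup commutativeSemigroup using (interchange)
  open import Relation.Binary.Reasoning.Setoid setoid

  private
    variable
      x y : Carrier
      b : Bool
      f g : ℕ → Carrier
      F : ℕ → ℕ → Carrier
      P : ℕ → Bool

  ∑ : ℕ → (ℕ → Carrier) → Carrier
  ∑ zero f = ε
  ∑ (suc n) f = ∑ n f ∙ f (suc n)

  infixl 8 _when_
  _when_ : Carrier → Bool → Carrier
  x when b = if b then x else ε

  when-congˡ : ∀ b → x ≈ y → x when b ≈ y when b
  when-congˡ true x≈y = x≈y
  when-congˡ false _ = ≈-refl

  ε-when : ∀ b → ε when b ≈ ε
  ε-when true = ≈-refl
  ε-when false = ≈-refl

  when-dec : ∀ {A : Set a} (a? : Dec A) → (A → y ≈ x) → (¬ A → y ≈ ε) → y ≈ x when does a?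
  when-dec (yes a) holds _ = holds a
  when-dec (no ¬a) _ fails = fails ¬a

  when-T : T b → x when b ≈ x
  when-T {true} _ = ≈-refl

  when-¬T : ¬ T b → x when b ≈ ε
  when-¬T {true} ¬T = contradiction tt ¬T
  when-¬T {false} _ = ≈-refl

  when-∧ : ∀ a b → (x when b) when a ≡ x when (a ∧ b)
  when-∧ true b = refl
  when-∧ false b = refl

  when-split : ∀ a b → x when b ≈ x when (not a ∧ b) ∙ x when (a ∧ b)
  when-split {x} true true = ≈-sym (identityˡ x)
  when-split {x} false true = ≈-sym (identityʳ x)
  when-split true false = ≈-sym (identityˡ ε)
  when-split false false = ≈-sym (identityˡ ε)

  foldr-range1 : ∀ n f → foldr (λ i acc → f i ∙ acc) ε (range1 n) ≈ ∑ n f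
  foldr-range1 zero f = ≈-refl
  foldr-range1 (suc n) f = begin
    foldr step ε (range1 (suc n))               ≡⟨ cong (foldr step ε) (range1-suc n) ⟩
    foldr step ε (range1 n ++ suc n ∷ [])       ≡⟨ foldr-++ step ε (range1 n) _ ⟩
    foldr step (f (suc n) ∙ ε) (range1 n)       ≈⟨ fold-from (range1 n) ⟩
    foldr step ε (range1 n) ∙ (f (suc n) ∙ ε)   ≈⟨ ∙-cong (foldr-range1 n f) (identityʳ _) ⟩
    ∑ n f ∙ f (suc n)                        ∎
    where
    step = λ i acc → f i ∙ acc
    fold-from : ∀ {a} xs → foldr step a xs ≈ foldr step ε xs ∙ a
    fold-from [] = ≈-sym (identityˡ _)
    fold-from (x ∷ xs) = ≈-trans (∙-congˡ (fold-from xs)) (≈-sym (assoc _ _ _))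

  ∑-cong : (∀ i → 1 ≤ i → i ≤ n → f i ≈ g i) → ∑ n f ≈ ∑ n g
  ∑-cong {zero} _ = ≈-refl
  ∑-cong {suc n} f≈g = ∙-cong (∑-cong λ i 1≤i i≤n → f≈g i 1≤i (m≤n⇒m≤1+n i≤n)) (f≈g (suc n) (s≤s z≤n) ≤-refl)

  ∑-ε : ∀ n → ∑ n (λ _ → ε) ≈ ε
  ∑-ε zero = ≈-refl
  ∑-ε (suc n) = ≈-trans (identityʳ _) (∑-ε n)

  ∑-zero : (∀ i → 1 ≤ i → i ≤ n → f i ≈ ε) → ∑ n f ≈ ε
  ∑-zero {n} f≈ε = ≈-trans (∑-cong f≈ε) (∑-ε n)

  ∑-distrib : ∀ n f g → ∑ n (λ i → f i ∙ g i) ≈ ∑ n f ∙ ∑ n g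
  ∑-distrib zero f g = ≈-sym (identityˡ ε)
  ∑-distrib (suc n) f g = ≈-trans (∙-congʳ (∑-distrib n f g)) (interchange _ _ _ _)

  ∑-when : ∀ n b → (∑ n f) when b ≈ ∑ n (λ i → f i when b)
  ∑-when n true = ≈-refl
  ∑-when n false = ≈-sym (∑-ε n)

  ∑-extend : m ≤ n → (∀ i → m < i → i ≤ n → f i ≈ ε) → ∑ m f ≈ ∑ n f
  ∑-extend {n = zero} z≤n _ = ≈-refl
  ∑-extend {m} {suc n} {f} m≤1+n f≈ε with m≤n⇒m<n∨m≡n m≤1+n
  ... | inj₂ refl = ≈-refl
  ... | inj₁ (s≤s m≤n) = begin
    ∑ m f              ≈⟨ ∑-extend m≤n (λ i m<i i≤n → f≈ε i m<i (m≤n⇒m≤1+n i≤n)) ⟩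
    ∑ n f              ≈⟨ identityʳ _ ⟨
    ∑ n f ∙ ε          ≈⟨ ∙-congˡ (f≈ε (suc n) (s≤s m≤n) ≤-refl) ⟨
    ∑ n f ∙ f (suc n)  ∎

  ∑-single : 1 ≤ p → p ≤ n → (∀ i → 1 ≤ i → i ≤ n → i ≢ p → f i ≈ ε) → ∑ n f ≈ f p
  ∑-single {suc p} {n} {f} _ p<n others = begin
    ∑ n f              ≈⟨ ∑-extend p<n above ⟨
    ∑ p f ∙ f (suc p)  ≈⟨ ∙-congʳ (∑-zero below) ⟩
    ε ∙ f (suc p)      ≈⟨ identityˡ _ ⟩
    f (suc p)          ∎
    where
    above : ∀ i → suc p < i → i ≤ n → f i ≈ ε
    above i p<i i≤n = others i (≤-trans (s≤s z≤n) p<i) i≤n (>⇒≢ p<i)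
    below : ∀ i → 1 ≤ i → i ≤ p → f i ≈ ε
    below i 1≤i i≤p = others i 1≤i (≤-trans (m≤n⇒m≤1+n i≤p) p<n) (<⇒≢ (s≤s i≤p))

  ∑-when-unique : 1 ≤ p → p ≤ n → T (P p) → (∀ {i} → 1 ≤ i → i ≤ n → T (P i) → i ≡ p) →
                  ∑ n (λ i → f i when P i) ≈ f p
  ∑-when-unique 1≤p p≤n Pp unique =
    ≈-trans (∑-single 1≤p p≤n (λ i 1≤i i≤n i≢p → when-¬T (i≢p ∘ unique 1≤i i≤n))) (when-T Pp)

  ∑-when-none : (∀ {i} → 1 ≤ i → i ≤ n → ¬ T (P i)) → ∑ n (λ i → f i when P i) ≈ ε
  ∑-when-none {n = n} none = ∑-zero {n} λ i 1≤i i≤n → when-¬T (none 1≤i i≤n)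

  ∑-swap : ∀ m n (F : ℕ → ℕ → Carrier) → ∑ m (λ i → ∑ n (F i)) ≈ ∑ n (λ j → ∑ m (λ i → F i j))
  ∑-swap zero n F = ≈-sym (∑-ε n)
  ∑-swap (suc m) n F = ≈-trans (∙-congʳ (∑-swap m n F)) (≈-sym (∑-distrib n _ (F (suc m))))

  ∑-swap-triangle : (∀ {i j} → 1 ≤ i → i < j → F i j ≈ ε) →
                    ∑ n (λ i → ∑ i (F i)) ≈ ∑ n (λ j → ∑ n (λ i → F i j))
  ∑-swap-triangle {F = F} {n = n} vanish =
    ≈-trans (∑-cong {n} λ i 1≤i i≤n → ∑-extend i≤n λ j i<j _ → vanish 1≤i i<j) (∑-swap n n F)

  ∑-multiples : 1 ≤ e → (∀ k → ¬ e ∣ k → f k ≈ ε) → ∀ m → ∑ (m * e) f ≈ ∑ m (λ j → f (j * e))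
  ∑-multiples _ _ zero = ≈-refl
  ∑-multiples {suc e′} {f} 1≤e vanish (suc m) = ∙-congʳ (≈-trans
    (≈-sym (∑-extend (m≤n+m (m * suc e′) e′) λ i lo hi → vanish i (∤-between-multiples {m} lo (s≤s hi))))
    (∑-multiples 1≤e vanish m))

  ∑-divisor-multiples : 1 ≤ e → n ≡ m * e →
    ∑ n (λ d → f d when (divides e d ∧ divides d n)) ≈ ∑ m (λ j → f (j * e) when divides j m)
  ∑-divisor-multiples {e} {m = m} {f} 1≤e refl = begin
    ∑ (m * e) (λ d → f d when (divides e d ∧ divides d (m * e)))
      ≈⟨ ∑-multiples 1≤e (λ k e∤k → when-¬T (e∤k ∘ T-does⁻ (e ∣? k) ∘ proj₁ ∘ Equivalence.to T-∧)) m ⟩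
    ∑ m (λ j → f (j * e) when (divides e (j * e) ∧ divides (j * e) (m * e)))
      ≈⟨ ∑-cong {m} (λ j _ _ → ≈-reflexive (cong (f (j * e) when_) (condition j))) ⟩
    ∑ m (λ j → f (j * e) when divides j m) ∎
    where
    condition : ∀ j → divides e (j * e) ∧ divides (j * e) (m * e) ≡ divides j m
    condition j = cong₂ _∧_ (dec-true (e ∣? j * e) (n∣m*n j))
      (does-⇔ (mk⇔ (*-cancelʳ-∣ e {{>-nonZero 1≤e}}) (*-monoˡ-∣ e)) (j * e ∣? m * e) (j ∣? m))

module UnitaryInversion {c ℓ} (R : CommutativeRing c ℓ) where

  open CommutativeRing R
    hiding (+-comm; *-comm; *-assoc)
    renaming ( _*_ to _·_; zero to ·-zero
             ; refl to ≈-refl; sym to ≈-sym; trans to ≈-trans; reflexive to ≈-reflexive)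
  open Sums R
  open RangeSum +-commutativeMonoid
  open import Algebra.Properties.Ring ring using (+-cancelˡ; -0#≈0#; -‿involutive; -‿+-comm)
  open import Relation.Binary.Reasoning.Setoid setoid

  private
    variable
      x y : Carrier

  μ : ℕ → Carrier
  μ n = intR (mobius n)

  intR-neg : ∀ z → intR (ℤ.- z) ≈ - intR z
  intR-neg (+ zero) = ≈-sym -0#≈0#
  intR-neg (+ suc n) = ≈-refl
  intR-neg ℤ.-[1+ n ] = ≈-sym (-‿involutive _)

  sumWhere≈∑ : ∀ n P h → sumWhere n P h ≈ ∑ n (λ d → h d when P d)
  sumWhere≈∑ n P h = foldr-range1 n (λ d → h d when P d)

  when-*ˡ : ∀ b → (x · y) when b ≈ x · (y when b)
  when-*ˡ true = ≈-refl
  when-*ˡ {x} false = ≈-sym (zeroʳ x)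

  when-neg : ∀ b → (- x) when b ≈ - (x when b)
  when-neg true = ≈-refl
  when-neg false = ≈-sym -0#≈0#

  ∑-*ˡ : ∀ n x f → ∑ n (λ i → x · f i) ≈ x · ∑ n f
  ∑-*ˡ zero x f = ≈-sym (zeroʳ x)
  ∑-*ˡ (suc n) x f = ≈-trans (+-congʳ (∑-*ˡ n x f)) (≈-sym (distribˡ x (∑ n f) (f (suc n))))

  ∑-neg : ∀ n f → ∑ n (λ i → - f i) ≈ - ∑ n f
  ∑-neg zero f = ≈-sym -0#≈0#
  ∑-neg (suc n) f = ≈-trans (+-congʳ (∑-neg n f)) (-‿+-comm (∑ n f) (f (suc n)))

  triangular-injective : (Q : ℕ → ℕ → Bool) → (∀ {n} → 1 ≤ n → T (Q n n)) → (a b : ℕ → Carrier) →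
    (∀ n → 1 ≤ n → sumWhere n (λ d → Q d n) a ≈ sumWhere n (λ d → Q d n) b) →
    ∀ n → 1 ≤ n → a n ≈ b n
  triangular-injective Q diagonal a b same = <-rec _ step
    where
    step : ∀ n → (∀ {m} → m < n → 1 ≤ m → a m ≈ b m) → 1 ≤ n → a n ≈ b n
    step (suc n) below 1≤n = +-cancelˡ (∑ n (restrict b)) (a (suc n)) (b (suc n)) (begin
      ∑ n (restrict b) + a (suc n)            ≈⟨ +-cong earlier (when-T (diagonal 1≤n)) ⟨
      ∑ (suc n) (restrict a)                  ≈⟨ sumWhere≈∑ (suc n) _ a ⟨
      sumWhere (suc n) (λ d → Q d (suc n)) a  ≈⟨ same (suc n) 1≤n ⟩
      sumWhere (suc n) (λ d → Q d (suc n)) b  ≈⟨ sumWhere≈∑ (suc n) _ b ⟩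
      ∑ (suc n) (restrict b)                  ≈⟨ +-congˡ (when-T (diagonal 1≤n)) ⟩
      ∑ n (restrict b) + b (suc n)            ∎)
      where
      restrict : (ℕ → Carrier) → ℕ → Carrier
      restrict c d = c d when Q d (suc n)
      earlier : ∑ n (restrict a) ≈ ∑ n (restrict b)
      earlier = ∑-cong {n} λ d 1≤d d≤n → when-congˡ (Q d (suc n)) (below (s≤s d≤n) 1≤d)

  -- For a prime p ∣ m the divisors of m divisible by p are the j * p with j ∣ m / p, and μ (j * p)
  -- is − μ j or 0; so they cancel the divisors prime to p.
  divSum-mobius-vanishes : 1 < m → divSum μ m ≈ 0#
  divSum-mobius-vanishes {m} 1<m with p , pp , mk∣ m′ m≡m′p ← ∃-prime-divisor 1<m = begin
    divSum μ m
      ≈⟨ sumWhere≈∑ m _ μ ⟩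
    ∑ m (λ j → μ j when divides j m)
      ≈⟨ ∑-cong {m} (λ j _ _ → when-split (divides p j) (divides j m)) ⟩
    ∑ m (λ j → μ j when (not (divides p j) ∧ divides j m) + μ j when (divides p j ∧ divides j m))
      ≈⟨ ∑-distrib m _ _ ⟩
    ∑ m (λ j → μ j when (not (divides p j) ∧ divides j m)) + ∑ m (λ j → μ j when (divides p j ∧ divides j m))
      ≈⟨ +-cong coprime-part multiple-part ⟩
    ∑ m′ coprime-term + - ∑ m′ coprime-term
      ≈⟨ -‿inverseʳ _ ⟩
    0# ∎
    where
    m≡pm′ : m ≡ p * m′
    m≡pm′ = trans m≡m′p (*-comm m′ p)
    m′∣m : m′ ∣ m
    m′∣m = mk∣ p m≡pm′
    1≤m′ : 1 ≤ m′
    1≤m′ = positive-divisor (<⇒≤ 1<m) m′∣m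
    coprime-term : ℕ → Carrier
    coprime-term j = μ j when (not (divides p j) ∧ divides j m′)
    coprime-condition : ∀ j → not (divides p j) ∧ divides j m ≡ not (divides p j) ∧ divides j m′
    coprime-condition j with p ∣? j
    ... | yes _ = refl
    ... | no p∤j = does-⇔ j∣m⇔j∣m′ (j ∣? m) (j ∣? m′)
      where
      j∣m⇔j∣m′ : j ∣ m ⇔ j ∣ m′
      j∣m⇔j∣m′ = mk⇔ (coprime-divisor (prime∤⇒coprime pp p∤j) ∘ subst (j ∣_) m≡pm′)
                     (subst (j ∣_) (sym m≡m′p) ∘ ∣m⇒∣m*n p)
    coprime-part : ∑ m (λ j → μ j when (not (divides p j) ∧ divides j m)) ≈ ∑ m′ coprime-term
    coprime-part = ≈-trans (∑-cong {m} λ j _ _ → ≈-reflexive (cong (μ j when_) (coprime-condition j)))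
                           (≈-sym (∑-extend (divisor-≤ (<⇒≤ 1<m) m′∣m) beyond))
      where
      beyond : ∀ j → m′ < j → j ≤ m → coprime-term j ≈ 0#
      beyond j m′<j _ = when-¬T {b = not (divides p j) ∧ divides j m′} λ t →
        <⇒≱ m′<j (divisor-≤ 1≤m′ (T-does⁻ (j ∣? m′) (proj₂ (Equivalence.to T-∧ t))))
    sign-flip : ∀ j → 1 ≤ j → μ (j * p) when divides j m′ ≈ - coprime-term j
    sign-flip j 1≤j with p ∣? j
    ... | yes p∣j = begin
      intR (mobius (j * p)) when divides j m′
        ≡⟨ cong (λ z → intR z when divides j m′) (mobius-square 1≤jp pp (*-monoˡ-∣ p p∣j)) ⟩
      0# when divides j m′                     ≈⟨ ε-when (divides j m′) ⟩
      0#                                       ≈⟨ -0#≈0# ⟨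
      - 0#                                     ∎
      where 1≤jp = ≤-trans 1≤j (m≤m*n j p {{prime⇒nonZero pp}})
    ... | no p∤j = begin
      intR (mobius (j * p)) when divides j m′
        ≡⟨ cong (λ z → intR z when divides j m′) (mobius-*prime 1≤j pp p∤j) ⟩
      intR (ℤ.- mobius j) when divides j m′    ≈⟨ when-congˡ (divides j m′) (intR-neg (mobius j)) ⟩
      (- μ j) when divides j m′                ≈⟨ when-neg (divides j m′) ⟩
      - (μ j when divides j m′)                ∎
    multiple-part : ∑ m (λ j → μ j when (divides p j ∧ divides j m)) ≈ - ∑ m′ coprime-term
    multiple-part = begin
      ∑ m (λ j → μ j when (divides p j ∧ divides j m))  ≈⟨ ∑-divisor-multiples {m = m′} (prime≥1 pp) m≡m′p ⟩
      ∑ m′ (λ j → μ (j * p) when divides j m′)          ≈⟨ ∑-cong {m′} (λ j 1≤j _ → sign-flip j 1≤j) ⟩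
      ∑ m′ (λ j → - coprime-term j)                     ≈⟨ ∑-neg m′ coprime-term ⟩
      - ∑ m′ coprime-term                               ∎

  divSum-mobius : 1 ≤ m → divSum μ m ≈ 1# when does (m ≟ 1)
  divSum-mobius {suc zero} _ = ≈-trans (+-identityʳ _) (+-identityʳ 1#)
  divSum-mobius {suc (suc m)} _ = divSum-mobius-vanishes {suc (suc m)} (s≤s (s≤s z≤n))

  kernelSum-interchange : ∀ n (F : ℕ → ℕ → Carrier) (S : ℕ → Bool) →
    ∑ n (λ d → kernelSum (λ e → F e d) d when S d) ≈ ∑ n (λ e → ∑ n (λ d → F e d when (S d ∧ does (e ∣κ? d))))
  kernelSum-interchange n F S = begin
    ∑ n (λ d → kernelSum (λ e → F e d) d when S d)
      ≈⟨ ∑-cong {n} (λ d _ _ → ≈-trans (when-congˡ (S d) (sumWhere≈∑ d (λ e → does (e ∣κ? d)) (λ e → F e d)))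
                                        (∑-when d (S d))) ⟩
    ∑ n (λ d → ∑ d (λ e → F e d when does (e ∣κ? d) when S d))
      ≈⟨ ∑-cong {n} (λ d _ _ → ∑-cong {d} (λ e _ _ → ≈-reflexive (when-∧ (S d) (does (e ∣κ? d))))) ⟩
    ∑ n (λ d → ∑ d (λ e → F e d when (S d ∧ does (e ∣κ? d))))
      ≈⟨ ∑-swap-triangle {n = n} (λ {d} {e} 1≤d d<e → when-¬T {b = S d ∧ does (e ∣κ? d)}
           λ t → <⇒≱ d<e (divisor-≤ 1≤d (proj₁ (T-does⁻ (e ∣κ? d) (proj₂ (Equivalence.to (T-∧ {S d}) t)))))) ⟩
    ∑ n (λ e → ∑ n (λ d → F e d when (S d ∧ does (e ∣κ? d)))) ∎

  ∑-unitary-kernel : 1 ≤ n → ∀ e x → ∑ n (λ d → x when (unitary d n ∧ does (e ∣κ? d))) ≈ x when divides e n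
  ∑-unitary-kernel {n} 1≤n e x = when-dec (e ∣? n) exactly-one none
    where
    conditions : ∀ {d} → T (unitary d n ∧ does (e ∣κ? d)) → d ∥ n × e ∣κ d
    conditions {d} t with d∥n , e∣κd ← Equivalence.to (T-∧ {unitary d n}) t =
      unitary⇒∥ d∥n , T-does⁻ (e ∣κ? d) e∣κd
    exactly-one : e ∣ n → ∑ n (λ d → x when (unitary d n ∧ does (e ∣κ? d))) ≈ x
    exactly-one e∣n with d₀ , d₀∥n , e∣d₀ , d₀⊆e ← ∥-saturate 1≤n e∣n =
      ∑-when-unique 1≤d₀ (divisor-≤ 1≤n (proj₁ d₀∥n)) d₀-qualifies unique
      where
      1≤d₀ = positive-divisor 1≤n (proj₁ d₀∥n)
      κe≡κd₀ = ⊆ₚ-antisym⇒kappa-≡ (positive-divisor 1≤n e∣n) 1≤d₀ (∣⇒⊆ₚ e∣d₀) d₀⊆e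
      d₀-qualifies : T (unitary d₀ n ∧ does (e ∣κ? d₀))
      d₀-qualifies = Equivalence.from (T-∧ {unitary d₀ n})
                       (∥⇒unitary 1≤d₀ d₀∥n , T-does⁺ (e ∣κ? d₀) (e∣d₀ , κe≡κd₀))
      unique : ∀ {d} → 1 ≤ d → d ≤ n → T (unitary d n ∧ does (e ∣κ? d)) → d ≡ d₀
      unique 1≤d _ t with d∥n , (e∣d , κe≡κd) ← conditions t =
        ∥-unique 1≤n d∥n d₀∥n (λ pp → ∣⇒⊆ₚ e∣d₀ pp ∘ kappa-≡⇒⊆ₚ 1≤d (sym κe≡κd) pp)
                              (λ pp → ∣⇒⊆ₚ e∣d pp ∘ d₀⊆e pp)
    none : ¬ e ∣ n → ∑ n (λ d → x when (unitary d n ∧ does (e ∣κ? d))) ≈ 0#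
    none e∤n = ∑-when-none {n} λ {d} _ _ t →
      let d∥n , (e∣d , _) = conditions {d} t in e∤n (∣-trans e∣d (proj₁ d∥n))

  divSum≈unitarySum∘kernelSum : ∀ g → 1 ≤ n → divSum g n ≈ unitarySum (kernelSum g) n
  divSum≈unitarySum∘kernelSum {n} g 1≤n = begin
    divSum g n
      ≈⟨ sumWhere≈∑ n _ g ⟩
    ∑ n (λ e → g e when divides e n)
      ≈⟨ ∑-cong {n} (λ e _ _ → ∑-unitary-kernel 1≤n e (g e)) ⟨
    ∑ n (λ e → ∑ n (λ d → g e when (unitary d n ∧ does (e ∣κ? d))))
      ≈⟨ kernelSum-interchange n (λ e _ → g e) (λ d → unitary d n) ⟨
    ∑ n (λ d → kernelSum g d when unitary d n)
      ≈⟨ sumWhere≈∑ n _ (kernelSum g) ⟨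
    unitarySum (kernelSum g) n ∎

  ∑-kernel-mobius : 1 ≤ n → ∀ e x →
    ∑ n (λ d → (x · μ (quot d e)) when (does (d ∣κ? n) ∧ does (e ∣κ? d))) ≈ x when does (e ≟ n)
  ∑-kernel-mobius {n} 1≤n e x with e ∣κ? n
  ... | no ¬e∣κn = ≈-trans
    (∑-when-none {n} λ {d} _ _ t → let d∣κn , e∣κd = T-does⁻ (d ∣κ? n ×-dec e ∣κ? d) t in
                                   ¬e∣κn (∣κ-trans e∣κd d∣κn))
    (≈-sym (when-¬T {b = does (e ≟ n)} λ t → ¬e∣κn (subst (_∣κ n) (sym (T-does⁻ (e ≟ n) t)) ∣κ-refl)))
  ... | yes e∣κn@(e∣n@(mk∣ m n≡me) , _) = begin
    ∑ n (λ d → (x · μ (quot d e)) when (does (d ∣κ? n) ∧ does (e ∣κ? d)))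
      ≈⟨ ∑-cong {n} (λ d _ _ → ≈-trans (≈-reflexive (cong ((x · μ (quot d e)) when_) (between d)))
                                        (when-*ˡ _)) ⟩
    ∑ n (λ d → x · μ (quot d e) when (divides e d ∧ divides d n))
      ≈⟨ ∑-*ˡ n x _ ⟩
    x · ∑ n (λ d → μ (quot d e) when (divides e d ∧ divides d n))
      ≈⟨ *-congˡ (∑-divisor-multiples {m = m} 1≤e n≡me) ⟩
    x · ∑ m (λ j → μ (quot (j * e) e) when divides j m)
      ≈⟨ *-congˡ (∑-cong {m} λ j _ _ → ≈-reflexive (cong (λ k → μ k when divides j m) (quot[m*n,n]≡m j 1≤e))) ⟩
    x · ∑ m (λ j → μ j when divides j m)
      ≈⟨ *-congˡ (sumWhere≈∑ m _ μ) ⟨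
    x · divSum μ m
      ≈⟨ *-congˡ (divSum-mobius 1≤m) ⟩
    x · 1# when does (m ≟ 1)
      ≈⟨ when-*ˡ (does (m ≟ 1)) ⟨
    (x · 1#) when does (m ≟ 1)
      ≈⟨ when-congˡ (does (m ≟ 1)) (*-identityʳ x) ⟩
    x when does (m ≟ 1)
      ≡⟨ cong (x when_) (does-⇔ (cofactor≡1⇔ 1≤e n≡me) (m ≟ 1) (e ≟ n)) ⟩
    x when does (e ≟ n) ∎
    where
    1≤e = positive-divisor 1≤n e∣n
    1≤m = positive-divisor 1≤n (mk∣ e (trans n≡me (*-comm m e)))
    between : ∀ d → does (d ∣κ? n) ∧ does (e ∣κ? d) ≡ divides e d ∧ divides d n
    between d = does-⇔ (∣κ-between 1≤n e∣κn) (d ∣κ? n ×-dec e ∣κ? d) (e ∣? d ×-dec d ∣? n)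

  kernelSum∘kernelMobiusSum : ∀ x → 1 ≤ n → kernelSum (kernelMobiusSum x) n ≈ x n
  kernelSum∘kernelMobiusSum {n} x 1≤n = begin
    kernelSum (kernelMobiusSum x) n
      ≈⟨ sumWhere≈∑ n (λ d → does (d ∣κ? n)) (kernelMobiusSum x) ⟩
    ∑ n (λ d → kernelMobiusSum x d when does (d ∣κ? n))
      ≈⟨ kernelSum-interchange n (λ e d → x e · μ (quot d e)) (λ d → does (d ∣κ? n)) ⟩
    ∑ n (λ e → ∑ n (λ d → (x e · μ (quot d e)) when (does (d ∣κ? n) ∧ does (e ∣κ? d))))
      ≈⟨ ∑-cong {n} (λ e _ _ → ∑-kernel-mobius 1≤n e (x e)) ⟩
    ∑ n (λ e → x e when does (e ≟ n))
      ≈⟨ ∑-when-unique 1≤n ≤-refl (T-does⁺ (n ≟ n) refl) (λ {i} _ _ → T-does⁻ (i ≟ n)) ⟩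
    x n ∎

theorem3 : {c ℓ : Level} (R : CommutativeRing c ℓ) →
    let open CommutativeRing R
        open Sums R
    in (g g* : ℕ → Carrier) →
       (∀ n → 1 ≤ n → divSum g n ≈ unitarySum g* n) →
       ∀ n → 1 ≤ n → (g* n ≈ kernelSum g n) × (g n ≈ kernelMobiusSum g* n)
theorem3 R g g* divSum≈unitarySum n 1≤n = g*≈kernelSum n 1≤n , g≈kernelMobiusSum n 1≤n
  where
  open CommutativeRing R using (_≈_) renaming (sym to ≈-sym; trans to ≈-trans)
  open Sums R
  open UnitaryInversion R

  g*≈kernelSum : ∀ n → 1 ≤ n → g* n ≈ kernelSum g n
  g*≈kernelSum = triangular-injective unitary (λ 1≤n → ∥⇒unitary 1≤n ∥-refl) g* (kernelSum g)
    λ n 1≤n → ≈-trans (≈-sym (divSum≈unitarySum n 1≤n)) (divSum≈unitarySum∘kernelSum g 1≤n)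

  g≈kernelMobiusSum : ∀ n → 1 ≤ n → g n ≈ kernelMobiusSum g* n
  g≈kernelMobiusSum =
    triangular-injective (λ d n → does (d ∣κ? n)) (λ {n} _ → T-does⁺ (n ∣κ? n) ∣κ-refl) g (kernelMobiusSum g*)
    λ n 1≤n → ≈-trans (≈-sym (g*≈kernelSum n 1≤n)) (≈-sym (kernelSum∘kernelMobiusSum g* 1≤n))
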